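{- Let $G$ be an undirected graph with $n\ge 2$ vertices. Consider the following procedure: for $k=2,3,4,\dots$ in turn, initialize an array of $2^{\binom{k}{2}}$ counters to zero, indexed by all labeled graphs on vertex set $\{1,\dots,k\}$ (encoded by the $\binom{k}{2}$ bits of the lower half of their adjacency matrices); for every ordered $k$-tuple $(v_1,\dots,v_k)$ of vertices of $G$, increment the counter indexed by the labeled graph on $\{1,\dots,k\}$ in which $a$ and $b$ are adjacent iff $v_a$ and $v_b$ are adjacent in $G$; then, if some counter is zero, output the corresponding graph and stop, and otherwise continue with $k+1$. This procedure stops (i.e., finds a zero counter) for some $k\le 2\log_2 n+2$.
   Context: All graphs are finite, simple and undirected. -}

module Defs where

open import Data.Nat using (ℕ)
open import Data.Fin using (Fin)
open import Data.Bool using (Bool; false)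
open import Data.Product using (∃-syntax)
open import Relation.Binary.PropositionalEquality using (_≡_)
open import Relation.Nullary using (¬_)

record Graph (n : ℕ) : Set where
  field
    adj    : Fin n → Fin n → Bool
    sym    : ∀ a b → adj a b ≡ adj b a
    irrefl : ∀ a → adj a a ≡ false

open Graph public

Increments : ∀ {n k} → Graph n → (Fin k → Fin n) → Graph k → Set
Increments G f H = ∀ a b → adj G (f a) (f b) ≡ adj H a b

CounterZero : ∀ {n} → Graph n → (k : ℕ) → Graph k → Set
CounterZero G k H = ¬ (∃[ f ] Increments G f H)

{-# OPTIONS --safe #-}
-- Counting: there are n ^ k ordered k-tuples of vertices but 2 ^ (k choose 2) labeled
-- graphs on k vertices, and every tuple increments exactly one counter. For
-- k = 2 + ⌊log₂ n²⌋ we have n² < 2 ^ (k - 1), hence n ^ (2k) < 2 ^ (k(k-1)), i.e.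
-- n ^ k < 2 ^ (k choose 2), and by the pigeonhole principle some counter stays zero.
module Submission where

open import Defs hiding (sym)
open import Data.Nat using (ℕ; _≤_; _∸_; _*_)
open import Data.Nat.Logarithm using (⌊log₂_⌋)
open import Data.Product using (_×_; ∃-syntax)

open import Algebra.Properties.CommutativeSemigroup using (interchange)
open import Data.Bool using (Bool; false)
import Data.Bool.Properties as Bool
open import Data.Fin using (Fin; zero; suc; combine; quotient; remainder; finToFun; funToFin)
open import Data.Fin.Properties
  using (2↔Bool; combine-remQuot; finToFun-funToFin; pigeonhole; all?; any?; ¬∀⟶∃¬; <⇒≢)
open import Data.Nat using (zero; suc; _+_; _^_; _<_; z≤n; s≤s)
open import Data.Nat.Logarithm using (⌊log₂⌋-mono-≤; ⌊log₂[2^n]⌋≡n)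
open import Data.Nat.Properties
  using (_<?_; ≮⇒≥; n≮n; <⇒≱; ≤-refl; *-mono-≤; *-commutativeSemigroup;
         ^-monoˡ-<; ^-*-assoc; ^-distribˡ-+-*; module ≤-Reasoning)
open import Data.Nat.Solver using (module +-*-Solver)
open import Data.Product using (_,_; proj₁; proj₂; map)
open import Function using (_∘_; id)
open import Function.Bundles using (Injection)
open import Function.Definitions using (Injective)
open import Function.Properties.Inverse using (↔⇒↣)
open import Relation.Binary.PropositionalEquality
open import Relation.Nullary using (Dec; yes; no; ¬_)
open import Relation.Nullary.Negation using (contradiction)

open Injection (↔⇒↣ 2↔Bool) using () renaming (to to toBool; injective to toBool-injective)

n<2^suc⌊log₂n⌋ : ∀ n → n < 2 ^ suc ⌊log₂ n ⌋
n<2^suc⌊log₂n⌋ n with n <? 2 ^ suc ⌊log₂ n ⌋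
... | yes n<2^L+1 = n<2^L+1
... | no n≮2^L+1 = contradiction
  (subst (_≤ ⌊log₂ n ⌋) (⌊log₂[2^n]⌋≡n (suc ⌊log₂ n ⌋))
         (⌊log₂⌋-mono-≤ (≮⇒≥ n≮2^L+1)))
  (n≮n ⌊log₂ n ⌋)

^-distribʳ-* : ∀ a b k → (a * b) ^ k ≡ a ^ k * b ^ k
^-distribʳ-* a b zero = refl
^-distribʳ-* a b (suc k) =
  trans (cong (a * b *_) (^-distribʳ-* a b k))
        (interchange *-commutativeSemigroup a b (a ^ k) (b ^ k))

m*m<n*n⇒m<n : ∀ {m n} → m * m < n * n → m < n
m*m<n*n⇒m<n {m} {n} m*m<n*n with m <? n
... | yes m<n = m<n
... | no m≮n = contradiction (*-mono-≤ (≮⇒≥ m≮n) (≮⇒≥ m≮n)) (<⇒≱ m*m<n*n)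

pairs : ℕ → ℕ
pairs zero = 0
pairs (suc k) = k + pairs k

pairs-double : ∀ m → pairs (suc m) + pairs (suc m) ≡ m * suc m
pairs-double zero = refl
pairs-double (suc m) = begin
  (suc m + P) + (suc m + P)      ≡⟨ solve 2 (λ x p → (x :+ p) :+ (x :+ p) := (x :+ x) :+ (p :+ p))
                                            refl (suc m) P ⟩
  (suc m + suc m) + (P + P)      ≡⟨ cong (suc m + suc m +_) (pairs-double m) ⟩
  (suc m + suc m) + m * suc m    ≡⟨ solve 1 (λ x → ((con 1 :+ x) :+ (con 1 :+ x)) :+ x :* (con 1 :+ x)
                                                  := (con 1 :+ x) :* (con 2 :+ x)) refl m ⟩
  suc m * suc (suc m)            ∎
  where
  open ≡-Reasoning
  open +-*-Solver
  P = pairs (suc m)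

tuples<graphs : ∀ n m → n * n < 2 ^ m → n ^ suc m < 2 ^ pairs (suc m)
tuples<graphs n m n*n<2^m = m*m<n*n⇒m<n (begin-strict
  n ^ k * n ^ k                  ≡⟨ ^-distribʳ-* n n k ⟨
  (n * n) ^ k                    <⟨ ^-monoˡ-< k n*n<2^m ⟩
  (2 ^ m) ^ k                    ≡⟨ ^-*-assoc 2 m k ⟩
  2 ^ (m * k)                    ≡⟨ cong (2 ^_) (pairs-double m) ⟨
  2 ^ (pairs k + pairs k)        ≡⟨ ^-distribˡ-+-* 2 (pairs k) (pairs k) ⟩
  2 ^ pairs k * 2 ^ pairs k      ∎)
  where
  open ≤-Reasoning
  k = suc m

quotient-remainder-injective : ∀ m n {i j : Fin (m * n)} →
  quotient {m} n i ≡ quotient n j → remainder {m} n i ≡ remainder {m} n j → i ≡ j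
quotient-remainder-injective m n {i} {j} q≡q r≡r = begin
  i                                               ≡⟨ combine-remQuot {m} n i ⟨
  combine (quotient {m} n i) (remainder {m} n i)  ≡⟨ cong₂ combine q≡q r≡r ⟩
  combine (quotient {m} n j) (remainder {m} n j)  ≡⟨ combine-remQuot {m} n j ⟩
  j                                               ∎
  where open ≡-Reasoning

finToFun-injective : ∀ m k {i j : Fin (m ^ k)} →
  (∀ a → finToFun {m} {k} i a ≡ finToFun j a) → i ≡ j
finToFun-injective m zero    {zero} {zero} _ = refl
finToFun-injective m (suc k) eq =
  quotient-remainder-injective m (m ^ k) (eq zero) (finToFun-injective m k (eq ∘ suc))

graphCodes : ℕ → ℕ
graphCodes zero = 1
graphCodes (suc k) = 2 ^ k * graphCodes k

graphCodes≡2^pairs : ∀ k → graphCodes k ≡ 2 ^ pairs k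
graphCodes≡2^pairs zero = refl
graphCodes≡2^pairs (suc k) =
  trans (cong (2 ^ k *_) (graphCodes≡2^pairs k)) (sym (^-distribˡ-+-* 2 k (pairs k)))

-- A code for a graph on suc k vertices is a pair: the 2 ^ k possible neighbourhoods of
-- vertex zero among the others, and a code for the graph on the remaining k vertices.
decodeAdj : ∀ k → Fin (graphCodes k) → Fin k → Fin k → Bool
decodeAdj (suc k) c zero    zero    = false
decodeAdj (suc k) c zero    (suc b) = toBool (finToFun (quotient (graphCodes k) c) b)
decodeAdj (suc k) c (suc a) zero    = toBool (finToFun (quotient (graphCodes k) c) a)
decodeAdj (suc k) c (suc a) (suc b) = decodeAdj k (remainder {2 ^ k} (graphCodes k) c) a b

decodeAdj-sym : ∀ k c a b → decodeAdj k c a b ≡ decodeAdj k c b a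
decodeAdj-sym (suc k) c zero    zero    = refl
decodeAdj-sym (suc k) c zero    (suc b) = refl
decodeAdj-sym (suc k) c (suc a) zero    = refl
decodeAdj-sym (suc k) c (suc a) (suc b) = decodeAdj-sym k _ a b

decodeAdj-irrefl : ∀ k c a → decodeAdj k c a a ≡ false
decodeAdj-irrefl (suc k) c zero    = refl
decodeAdj-irrefl (suc k) c (suc a) = decodeAdj-irrefl k _ a

infix 4 _≈ᵍ_
_≈ᵍ_ : ∀ {k} → Graph k → Graph k → Set
H ≈ᵍ H′ = ∀ a b → adj H a b ≡ adj H′ a b

decode : ∀ k → Fin (graphCodes k) → Graph k
decode k c = record
  { adj = decodeAdj k c ; sym = decodeAdj-sym k c ; irrefl = decodeAdj-irrefl k c }

decode-injective : ∀ k → Injective _≡_ _≈ᵍ_ (decode k)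
decode-injective zero {zero} {zero} _ = refl
decode-injective (suc k) eq = quotient-remainder-injective (2 ^ k) (graphCodes k)
  (finToFun-injective 2 k (λ b → toBool-injective (eq zero (suc b))))
  (decode-injective k (λ a b → eq (suc a) (suc b)))

module _ {n : ℕ} (G : Graph n) where

  increments? : ∀ {k} (f : Fin k → Fin n) (H : Graph k) → Dec (Increments G f H)
  increments? f H = all? λ a → all? λ b → adj G (f a) (f b) Bool.≟ adj H a b

  -- Tuples are enumerated through their codes in Fin (n ^ k), making the search finite.
  Counted : ∀ {k} → Graph k → Set
  Counted {k} H = ∃[ t ] Increments G (finToFun {n} {k} t) H

  counted? : ∀ {k} (H : Graph k) → Dec (Counted H)
  counted? H = any? λ t → increments? (finToFun t) H

  ¬counted⇒counterZero : ∀ {k} (H : Graph k) → ¬ Counted H → CounterZero G k H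
  ¬counted⇒counterZero H ¬counted (f , incr) =
    ¬counted (funToFin f , λ a b →
      trans (cong₂ (adj G) (finToFun-funToFin f a) (finToFun-funToFin f b)) (incr a b))

  increments-unique : ∀ {k} (f : Fin k → Fin n) {H H′ : Graph k} →
    Increments G f H → Increments G f H′ → H ≈ᵍ H′
  increments-unique f incr incr′ a b = trans (sym (incr a b)) (incr′ a b)

  ¬all-counted : ∀ {k m} (H : Fin m → Graph k) →
    Injective _≡_ _≈ᵍ_ H →
    n ^ k < m → ¬ (∀ i → Counted (H i))
  ¬all-counted {k} {m} H H-injective n^k<m counted with pigeonhole n^k<m (proj₁ ∘ counted)
  ... | i , j , i<j , tᵢ≡tⱼ =
    <⇒≢ i<j (H-injective (increments-unique (tuple i) {H i} {H j} (incr i) incrⱼ))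
    where
    tuple : Fin m → Fin k → Fin n
    tuple i = finToFun (proj₁ (counted i))
    incr : ∀ i → Increments G (tuple i) (H i)
    incr i = proj₂ (counted i)
    incrⱼ : Increments G (tuple i) (H j)
    incrⱼ = subst (λ t → Increments G (finToFun t) (H j)) (sym tᵢ≡tⱼ) (incr j)

  ∃-counterZero : ∀ {k m} (H : Fin m → Graph k) →
    Injective _≡_ _≈ᵍ_ H →
    n ^ k < m → ∃[ i ] CounterZero G k (H i)
  ∃-counterZero {m = m} H H-injective n^k<m
    with ¬∀⟶∃¬ m (λ i → Counted (H i)) (λ i → counted? (H i))
               (¬all-counted H H-injective n^k<m)
  ... | i , ¬counted = i , ¬counted⇒counterZero (H i) ¬counted

lemma1 : (n : ℕ) → 2 ≤ n → (G : Graph n) →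
    ∃[ k ] (2 ≤ k × k ∸ 2 ≤ ⌊log₂ (n * n) ⌋ × ∃[ H ] CounterZero G k H)
lemma1 n _ G = k , s≤s (s≤s z≤n) , ≤-refl ,
  map (decode k) id (∃-counterZero G (decode k) (decode-injective k) n^k<graphCodes)
  where
  L = ⌊log₂ (n * n) ⌋
  k = 2 + L
  n^k<graphCodes : n ^ k < graphCodes k
  n^k<graphCodes = subst (n ^ k <_) (sym (graphCodes≡2^pairs k))
    (tuples<graphs n (suc L) (n<2^suc⌊log₂n⌋ (n * n)))
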